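{- Let $G$ be a finite abelian group, $H$ a subgroup of $G$ of odd order, and $\alpha$ an involutory automorphism of $G$ with $H\le\omega_\alpha(G)$. Then there exists a generalized Cayley subset $S$ of $G$ induced by $\alpha$ such that $H$ is a perfect code of $GC(G,S,\alpha)$ if and only if $H=\omega_\alpha(G)$.
   Context: For a finite group $G$ with identity $e$, an involutory automorphism is $\alpha\in\mathrm{Aut}(G)$ with $\alpha^2=\mathrm{id}\neq\alpha$. Set $\omega_\alpha(G)=\{\alpha(g^{ -1})g\mid g\in G\}$. A subset $S\subseteq G$ is a generalized Cayley subset of $G$ induced by $\alpha$ if $S\cap\omega_\alpha(G)=\emptyset$ and $\alpha(S)=S^{ -1}$ (where $\alpha(A)=\{\alpha(a)\mid a\in A\}$, $A^{ -1}=\{a^{ -1}\mid a\in A\}$). The generalized Cayley graph $GC(G,S,\alpha)$ has vertex set $G$ and edge set $\{\{g,h\}\mid \alpha(g^{ -1})h\in S\}$. A subset $C$ of the vertex set of a graph is a perfect code if $C$ is independent and every vertex outside $C$ is adjacent to exactly one vertex of $C$. -}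

module Defs where

open import Data.Nat using (ℕ; suc; _*_; _+_)
open import Data.Fin using (Fin)
open import Data.Fin.Subset using (Subset; _∈_; _∉_; ∣_∣)
open import Data.Product using (Σ; ∃; _×_; _,_)
open import Data.Sum using (_⊎_)
open import Relation.Nullary using (¬_)
open import Relation.Binary.PropositionalEquality using (_≡_; _≢_)
open import Algebra.Structures using (IsAbelianGroup)
open import Level using (0ℓ)

-- A finite abelian group, presented (up to isomorphism) on the carrier Fin n,
-- with propositional equality.
record FinAbGroup : Set where
  field
    n     : ℕ
    _∙_   : Fin n → Fin n → Fin n
    ε     : Fin n
    _⁻¹   : Fin n → Fin n
    isAbelianGroup : IsAbelianGroup _≡_ _∙_ ε _⁻¹

module _ (G : FinAbGroup) where
  open FinAbGroup G

  IsSubgroup : Subset n → Set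
  IsSubgroup H = (ε ∈ H)
               × (∀ {x y} → x ∈ H → y ∈ H → (x ∙ y) ∈ H)
               × (∀ {x} → x ∈ H → (x ⁻¹) ∈ H)

  OddOrder : Subset n → Set
  OddOrder H = Σ ℕ λ k → ∣ H ∣ ≡ suc (2 * k)

  IsAutomorphism : (Fin n → Fin n) → Set
  IsAutomorphism α = (∀ x y → α (x ∙ y) ≡ α x ∙ α y)
                   × (∀ {x y} → α x ≡ α y → x ≡ y)
                   × (∀ y → ∃ λ x → α x ≡ y)

  IsInvolutoryAut : (Fin n → Fin n) → Set
  IsInvolutoryAut α = IsAutomorphism α
                    × (∀ x → α (α x) ≡ x)
                    × (∃ λ x → α x ≢ x)

  InOmega : (Fin n → Fin n) → Fin n → Set
  InOmega α x = ∃ λ g → x ≡ α (g ⁻¹) ∙ g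

  IsGenCayleySubset : (Fin n → Fin n) → Subset n → Set
  IsGenCayleySubset α S =
      (∀ {s} → s ∈ S → ¬ InOmega α s)
    × (∀ x → ((∃ λ s → s ∈ S × x ≡ α s) → (∃ λ s → s ∈ S × x ≡ s ⁻¹))
           × ((∃ λ s → s ∈ S × x ≡ s ⁻¹) → (∃ λ s → s ∈ S × x ≡ α s)))

  -- adjacency in GC(G,S,α): {g,h} is an edge iff α(g⁻¹)h ∈ S
  -- (the edge set is a set of unordered pairs, so either orientation counts)
  GCAdj : (Fin n → Fin n) → Subset n → Fin n → Fin n → Set
  GCAdj α S g h = ((α (g ⁻¹) ∙ h) ∈ S) ⊎ ((α (h ⁻¹) ∙ g) ∈ S)

  IsPerfectCode : (Fin n → Fin n) → Subset n → Subset n → Set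
  IsPerfectCode α S C =
      (∀ {c c'} → c ∈ C → c' ∈ C → ¬ GCAdj α S c c')
    × (∀ v → v ∉ C → ∃ λ c → c ∈ C × GCAdj α S v c
                       × (∀ c' → c' ∈ C → GCAdj α S v c' → c' ≡ c))

{-# OPTIONS --safe #-}

-- Put β x = α (x ⁻¹). As G is abelian, β is an involutive automorphism, ω_α(G) = { β g ∙ g } is a
-- subgroup fixed pointwise by β, and β x ∙ x ∈ ω_α(G) says that β induces inversion on G / ω_α(G).
-- The edge condition α(g⁻¹) h ∈ S reads β g ∙ h ∈ S, so ω_α(G) is independent in GC(G,S,α) when S
-- avoids it; a perfect code inside ω_α(G) must then contain all of ω_α(G).
-- Conversely, for H = ω_α(G) the condition α(S) = S⁻¹ becomes β(S) = S, and H is a perfect code as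
-- soon as S meets every nontrivial coset of H exactly once. Such a β-invariant transversal is chosen
-- pair by pair: for aH ≠ a⁻¹H take the least element m of aH ∪ a⁻¹H together with β m; a self-inverse
-- coset contains exactly one element of order at most 2, and β fixes it. That element exists and is
-- unique because |H| is odd: an involution of a set of odd size has a fixed point.

module Submission where

open import Defs
open import Algebra.Bundles using (AbelianGroup)
open import Data.Nat using (ℕ; zero; suc; _*_; z≤n; s≤s)
open import Data.Nat.Properties using (*-suc; suc-injective)
open import Data.Fin using (Fin; zero; suc; _≤_; _≟_)
open import Data.Fin.Properties using (≤-antisym)
open import Data.Fin.Subset using (Subset; _∈_; _∉_; ∣_∣; _-_; ⁅_⁆; Nonempty; inside; outside)
open import Data.Fin.Subset.Properties
  using (_∈?_; nonempty?; Empty-unique; ∣⊥∣≡0; p─⊥≡p; p─q⊆p; x∈p∧x≢y⇒x∈p-y)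
open import Data.Product using (Σ; ∃; _×_; _,_; proj₁; proj₂)
open import Data.Sum using (_⊎_; inj₁; inj₂)
open import Data.Vec using (_∷_; tabulate; here; there)
open import Data.Vec.Properties using (lookup∘tabulate; []=⇒lookup; lookup⇒[]=)
open import Function using (_∘_)
open import Level using (Level; 0ℓ)
open import Relation.Binary.Core using (Rel)
open import Relation.Binary.Structures using (IsDecEquivalence)
open import Relation.Binary.PropositionalEquality
  using (_≡_; _≢_; refl; sym; trans; cong; cong₂; subst; subst₂; module ≡-Reasoning)
open import Relation.Nullary using (¬_; Dec; yes; no; does; proof; contradiction; Reflects; invert)
open import Relation.Nullary.Decidable using (_×-dec_; _⊎-dec_; ¬?; dec-true)
open import Relation.Unary using (Pred; Decidable; Satisfiable; _≐_)

module FinCombinatorics where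

  private
    variable
      ℓ : Level
      n : ℕ
      p : Subset n
      x y : Fin n

  ∣p∣≡1+∣p-x∣ : x ∈ p → ∣ p ∣ ≡ suc ∣ p - x ∣
  ∣p∣≡1+∣p-x∣ {p = inside ∷ p} here = cong suc (cong ∣_∣ (sym (p─⊥≡p p)))
  ∣p∣≡1+∣p-x∣ {p = inside ∷ p} (there x∈p) = cong suc (∣p∣≡1+∣p-x∣ x∈p)
  ∣p∣≡1+∣p-x∣ {p = outside ∷ p} (there x∈p) = ∣p∣≡1+∣p-x∣ x∈p

  x∉p-x : x ∉ p - x
  x∉p-x {x = zero} {p = _ ∷ _} ()
  x∉p-x {x = suc x} {p = _ ∷ _} (there x∈p-x) = x∉p-x x∈p-x

  ∣p∣≡suc⇒nonempty : ∀ {n m} {p : Subset n} → ∣ p ∣ ≡ suc m → Nonempty p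
  ∣p∣≡suc⇒nonempty {n} {p = p} ∣p∣≡1+m with nonempty? p
  ... | yes ne = ne
  ... | no ¬ne with () ← trans (sym (∣⊥∣≡0 n)) (trans (cong ∣_∣ (sym (Empty-unique ¬ne))) ∣p∣≡1+m)

  x∈p-y⇒x≢y : x ∈ p - y → x ≢ y
  x∈p-y⇒x≢y x∈p-x refl = x∉p-x x∈p-x

  p-y⊆p : x ∈ p - y → x ∈ p
  p-y⊆p {p = p} {y = y} = p─q⊆p p ⁅ y ⁆

  module _ (f : Fin n → Fin n) (f-involutive : ∀ x → f (f x) ≡ x) where
    open ≡-Reasoning

    ∈-remove-orbit : ∀ {p x y} → (∀ {z} → z ∈ p → f z ∈ p) → y ∈ p - x - f x → f y ∈ p - x - f x
    ∈-remove-orbit {p} {x} {y} p-closed y∈p' =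
      x∈p∧x≢y⇒x∈p-y (x∈p∧x≢y⇒x∈p-y (p-closed y∈p) fy≢x) fy≢fx
      where
      y∈p-x : y ∈ p - x
      y∈p-x = p-y⊆p y∈p'
      y∈p : y ∈ p
      y∈p = p-y⊆p y∈p-x
      fy≢x : f y ≢ x
      fy≢x fy≡x = x∈p-y⇒x≢y y∈p' (trans (sym (f-involutive y)) (cong f fy≡x))
      fy≢fx : f y ≢ f x
      fy≢fx fy≡fx = x∈p-y⇒x≢y y∈p-x (trans (sym (f-involutive y)) (trans (cong f fy≡fx) (f-involutive x)))

    ∣p∣≡2+∣p-orbit∣ : ∀ {p x} → (∀ {z} → z ∈ p → f z ∈ p) → x ∈ p → f x ≢ x →
                      ∣ p ∣ ≡ suc (suc ∣ p - x - f x ∣)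
    ∣p∣≡2+∣p-orbit∣ p-closed x∈p fx≢x =
      trans (∣p∣≡1+∣p-x∣ x∈p) (cong suc (∣p∣≡1+∣p-x∣ (x∈p∧x≢y⇒x∈p-y (p-closed x∈p) fx≢x)))

    odd-involution-fixedPoint : ∀ k {p} → ∣ p ∣ ≡ suc (2 * k) → (∀ {z} → z ∈ p → f z ∈ p) →
                                ∃ λ x → x ∈ p × f x ≡ x
    odd-involution-fixedPoint k {p} ∣p∣≡ p-closed with ∣p∣≡suc⇒nonempty ∣p∣≡
    ... | x , x∈p with f x ≟ x
    ...   | yes fx≡x = x , x∈p , fx≡x
    odd-involution-fixedPoint zero ∣p∣≡ p-closed | x , x∈p | no fx≢x
      with () ← suc-injective (trans (sym ∣p∣≡) (∣p∣≡2+∣p-orbit∣ p-closed x∈p fx≢x))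
    odd-involution-fixedPoint (suc k) {p} ∣p∣≡ p-closed | x , x∈p | no fx≢x =
      let y , y∈p' , fy≡y = odd-involution-fixedPoint k ∣p'∣≡ (∈-remove-orbit p-closed)
      in y , p-y⊆p (p-y⊆p y∈p') , fy≡y
      where
      ∣p'∣≡ : ∣ p - x - f x ∣ ≡ suc (2 * k)
      ∣p'∣≡ = suc-injective (suc-injective (begin
        suc (suc ∣ p - x - f x ∣)  ≡⟨ ∣p∣≡2+∣p-orbit∣ p-closed x∈p fx≢x ⟨
        ∣ p ∣                      ≡⟨ ∣p∣≡ ⟩
        suc (2 * suc k)            ≡⟨ cong suc (*-suc 2 k) ⟩
        suc (suc (suc (2 * k)))    ∎))

  fromDecidable : {P : Pred (Fin n) ℓ} → Decidable P → Subset n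
  fromDecidable P? = tabulate (does ∘ P?)

  module _ {P : Pred (Fin n) ℓ} (P? : Decidable P) where

    ∈-fromDecidable⁺ : P x → x ∈ fromDecidable P?
    ∈-fromDecidable⁺ {x} Px = lookup⇒[]= x _ (trans (lookup∘tabulate (does ∘ P?) x) (dec-true (P? x) Px))

    ∈-fromDecidable⁻ : x ∈ fromDecidable P? → P x
    ∈-fromDecidable⁻ {x} x∈ =
      invert (subst (Reflects (P x)) (trans (sym (lookup∘tabulate (does ∘ P?) x)) ([]=⇒lookup x∈))
                    (proof (P? x)))

  Least : Pred (Fin n) ℓ → Fin n → Set ℓ
  Least P x = P x × (∀ {y} → P y → x ≤ y)

  least : {P : Pred (Fin n) ℓ} → Decidable P → Satisfiable P → ∃ (Least P)
  least {n = suc n} P? (x , Px) with P? zero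
  ... | yes P0 = zero , P0 , λ _ → z≤n
  least {n = suc n} P? (zero , P0) | no ¬P0 = contradiction P0 ¬P0
  least {n = suc n} P? (suc x , Px) | no ¬P0 with y , Py , y-min ← least (P? ∘ suc) (x , Px)
    = suc y , Py , λ { {zero} P0 → contradiction P0 ¬P0 ; {suc z} Pz → s≤s (y-min Pz) }

  Least-unique : {P Q : Pred (Fin n) ℓ} → P ≐ Q → Least P x → Least Q y → x ≡ y
  Least-unique (P⊆Q , Q⊆P) (Px , x-min) (Qy , y-min) = ≤-antisym (x-min (Q⊆P Qy)) (y-min (P⊆Q Px))

  module _ {_≈_ : Rel (Fin n) ℓ} (≈-isDecEquivalence : IsDecEquivalence _≈_) where
    open IsDecEquivalence ≈-isDecEquivalence
      renaming (refl to ≈-refl; sym to ≈-sym; trans to ≈-trans; _≟_ to _≈?_)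

    private
      leastInClass-spec : ∀ x → ∃ (Least (x ≈_))
      leastInClass-spec x = least (x ≈?_) (x , ≈-refl)

    leastInClass : Fin n → Fin n
    leastInClass = proj₁ ∘ leastInClass-spec

    ≈-leastInClass : ∀ x → x ≈ leastInClass x
    ≈-leastInClass = proj₁ ∘ proj₂ ∘ leastInClass-spec

    leastInClass-cong : x ≈ y → leastInClass x ≡ leastInClass y
    leastInClass-cong {x} {y} x≈y = Least-unique
      (≈-trans (≈-sym x≈y) , ≈-trans x≈y) (proj₂ (leastInClass-spec x)) (proj₂ (leastInClass-spec y))

open FinCombinatorics

module _ (G : FinAbGroup) where
  open FinAbGroup G using (n; isAbelianGroup)

  private
    abelianGroup : AbelianGroup 0ℓ 0ℓ
    abelianGroup = record { isAbelianGroup = isAbelianGroup }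

  open AbelianGroup abelianGroup using (_∙_; ε; _⁻¹; assoc; comm; identityˡ; identityʳ; inverseˡ; inverseʳ)

  open import Algebra.Properties.AbelianGroup abelianGroup
    using (⁻¹-involutive; ⁻¹-anti-homo-∙; ⁻¹-∙-comm; inverseʳ-unique; identityˡ-unique; identityʳ-unique;
           \\-leftDividesˡ; \\-leftDividesʳ; //-rightDividesˡ; xyx⁻¹≈y)
  open import Algebra.Properties.CommutativeSemigroup (AbelianGroup.commutativeSemigroup abelianGroup)
    using (interchange)
  open ≡-Reasoning

  module _ {f : Fin n → Fin n} (f-hom : ∀ x y → f (x ∙ y) ≡ f x ∙ f y) where

    ∙-homo⇒ε-homo : f ε ≡ ε
    ∙-homo⇒ε-homo = identityʳ-unique (f ε) (f ε) (trans (sym (f-hom ε ε)) (cong f (identityˡ ε)))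

    ∙-homo⇒⁻¹-homo : ∀ x → f (x ⁻¹) ≡ f x ⁻¹
    ∙-homo⇒⁻¹-homo x = inverseʳ-unique (f x) (f (x ⁻¹))
      (trans (sym (f-hom x (x ⁻¹))) (trans (cong f (inverseʳ x)) ∙-homo⇒ε-homo))

  module Cosets {H : Subset n} (H≤G : IsSubgroup G H) where
    private
      ε∈H : ε ∈ H
      ε∈H = proj₁ H≤G
      ∙-∈ : ∀ {x y} → x ∈ H → y ∈ H → x ∙ y ∈ H
      ∙-∈ = proj₁ (proj₂ H≤G)
      ⁻¹-∈ : ∀ {x} → x ∈ H → x ⁻¹ ∈ H
      ⁻¹-∈ = proj₂ (proj₂ H≤G)

    infix 4 _~_ _~?_
    _~_ : Fin n → Fin n → Set
    a ~ b = a ⁻¹ ∙ b ∈ H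

    _~?_ : ∀ a b → Dec (a ~ b)
    a ~? b = a ⁻¹ ∙ b ∈? H

    ~-refl : ∀ {a} → a ~ a
    ~-refl {a} = subst (_∈ H) (sym (inverseˡ a)) ε∈H

    ~-sym : ∀ {a b} → a ~ b → b ~ a
    ~-sym {a} {b} a~b = subst (_∈ H) eq (⁻¹-∈ a~b)
      where
      eq : (a ⁻¹ ∙ b) ⁻¹ ≡ b ⁻¹ ∙ a
      eq = trans (⁻¹-anti-homo-∙ (a ⁻¹) b) (cong (b ⁻¹ ∙_) (⁻¹-involutive a))

    ~-trans : ∀ {a b c} → a ~ b → b ~ c → a ~ c
    ~-trans {a} {b} {c} a~b b~c = subst (_∈ H) eq (∙-∈ a~b b~c)
      where
      eq : (a ⁻¹ ∙ b) ∙ (b ⁻¹ ∙ c) ≡ a ⁻¹ ∙ c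
      eq = trans (assoc (a ⁻¹) b (b ⁻¹ ∙ c)) (cong (a ⁻¹ ∙_) (\\-leftDividesˡ b c))

    ~-⁻¹ : ∀ {a b} → a ~ b → a ⁻¹ ~ b ⁻¹
    ~-⁻¹ {a} {b} a~b = subst (_∈ H) eq (~-sym a~b)
      where
      eq : b ⁻¹ ∙ a ≡ a ⁻¹ ⁻¹ ∙ b ⁻¹
      eq = trans (comm (b ⁻¹) a) (cong (_∙ b ⁻¹) (sym (⁻¹-involutive a)))

    ∈-resp-~ : ∀ {a b} → a ~ b → a ∈ H → b ∈ H
    ∈-resp-~ {a} {b} a~b a∈H = subst (_∈ H) (\\-leftDividesˡ a b) (∙-∈ a∈H a~b)

    ~-∙-∈ : ∀ {a h} → h ∈ H → a ~ a ∙ h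
    ~-∙-∈ {a} {h} h∈H = subst (_∈ H) (sym (\\-leftDividesʳ a h)) h∈H

    ⁻¹~⇒~⁻¹ : ∀ {a b} → a ⁻¹ ~ b → a ~ b ⁻¹
    ⁻¹~⇒~⁻¹ {a} {b} a⁻¹~b = subst (_~ b ⁻¹) (⁻¹-involutive a) (~-⁻¹ a⁻¹~b)

    selfInverse-resp-~ : ∀ {a b} → a ~ b → a ~ a ⁻¹ → b ~ b ⁻¹
    selfInverse-resp-~ a~b a~a⁻¹ = ~-trans (~-sym a~b) (~-trans a~a⁻¹ (~-⁻¹ a~b))

    square≡ε⇒selfInverse : ∀ {t} → t ∙ t ≡ ε → t ~ t ⁻¹
    square≡ε⇒selfInverse {t} tt≡ε = subst (t ~_) (inverseʳ-unique t t tt≡ε) ~-refl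

    module OfOddOrder (odd : OddOrder G H) where

      -- w ∙ x ⁻¹ is an involution of H; its fixed points are the square roots of w
      ∃-sqrt : ∀ {w} → w ∈ H → ∃ λ u → u ∈ H × u ∙ u ≡ w
      ∃-sqrt {w} w∈H =
        let u , u∈H , w/u≡u = odd-involution-fixedPoint f f-involutive (proj₁ odd) (proj₂ odd) f-closed
        in u , u∈H , trans (cong (_∙ u) (sym w/u≡u)) (//-rightDividesˡ u w)
        where
        f : Fin n → Fin n
        f x = w ∙ x ⁻¹
        f-involutive : ∀ x → f (f x) ≡ x
        f-involutive x = begin
          w ∙ (w ∙ x ⁻¹) ⁻¹      ≡⟨ cong (w ∙_) (⁻¹-anti-homo-∙ w (x ⁻¹)) ⟩
          w ∙ (x ⁻¹ ⁻¹ ∙ w ⁻¹)   ≡⟨ cong (λ y → w ∙ (y ∙ w ⁻¹)) (⁻¹-involutive x) ⟩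
          w ∙ (x ∙ w ⁻¹)         ≡⟨ assoc w x (w ⁻¹) ⟨
          w ∙ x ∙ w ⁻¹           ≡⟨ xyx⁻¹≈y w x ⟩
          x                      ∎
        f-closed : ∀ {x} → x ∈ H → f x ∈ H
        f-closed x∈H = ∙-∈ w∈H (⁻¹-∈ x∈H)

      -- v ∙_ is an involution of H; a fixed point forces v ≡ ε
      square≡ε⇒≡ε : ∀ {v} → v ∈ H → v ∙ v ≡ ε → v ≡ ε
      square≡ε⇒≡ε {v} v∈H vv≡ε =
        let x , _ , vx≡x = odd-involution-fixedPoint (v ∙_) v∙-involutive (proj₁ odd) (proj₂ odd) (∙-∈ v∈H)
        in identityˡ-unique v x vx≡x
        where
        v∙-involutive : ∀ x → v ∙ (v ∙ x) ≡ x
        v∙-involutive x = trans (sym (assoc v v x)) (trans (cong (_∙ x) vv≡ε) (identityˡ x))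

      ∃-square≡ε : ∀ {y} → y ~ y ⁻¹ → ∃ λ t → y ~ t × t ∙ t ≡ ε
      ∃-square≡ε {y} y~y⁻¹ =
        let u , u∈H , uu≡ = ∃-sqrt y~y⁻¹
        in y ∙ u , ~-∙-∈ u∈H , (begin
          (y ∙ u) ∙ (y ∙ u)          ≡⟨ interchange y u y u ⟩
          (y ∙ y) ∙ (u ∙ u)          ≡⟨ cong ((y ∙ y) ∙_) uu≡ ⟩
          (y ∙ y) ∙ (y ⁻¹ ∙ y ⁻¹)    ≡⟨ cong ((y ∙ y) ∙_) (⁻¹-∙-comm y y) ⟩
          (y ∙ y) ∙ (y ∙ y) ⁻¹       ≡⟨ inverseʳ (y ∙ y) ⟩
          ε                          ∎)

      square≡ε-unique : ∀ {t t'} → t ~ t' → t ∙ t ≡ ε → t' ∙ t' ≡ ε → t ≡ t'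
      square≡ε-unique {t} {t'} t~t' tt≡ε t't'≡ε = begin
        t                   ≡⟨ identityʳ t ⟨
        t ∙ ε               ≡⟨ cong (t ∙_) (square≡ε⇒≡ε t~t' dd≡ε) ⟨
        t ∙ (t ⁻¹ ∙ t')     ≡⟨ \\-leftDividesˡ t t' ⟩
        t'                  ∎
        where
        dd≡ε : (t ⁻¹ ∙ t') ∙ (t ⁻¹ ∙ t') ≡ ε
        dd≡ε = begin
          (t ⁻¹ ∙ t') ∙ (t ⁻¹ ∙ t')  ≡⟨ interchange (t ⁻¹) t' (t ⁻¹) t' ⟩
          (t ⁻¹ ∙ t ⁻¹) ∙ (t' ∙ t')  ≡⟨ cong₂ _∙_ (⁻¹-∙-comm t t) t't'≡ε ⟩
          (t ∙ t) ⁻¹ ∙ ε             ≡⟨ cong (λ z → z ⁻¹ ∙ ε) tt≡ε ⟩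
          ε ⁻¹ ∙ ε                   ≡⟨ inverseˡ ε ⟩
          ε                          ∎

      module InvariantTransversal
        (β : Fin n → Fin n) (β-hom : ∀ x y → β (x ∙ y) ≡ β x ∙ β y)
        (β-involutive : ∀ x → β (β x) ≡ x) (β-inverts : ∀ x → β x ~ x ⁻¹) where

        β-∈ : ∀ {h} → h ∈ H → β h ∈ H
        β-∈ {h} h∈H = ∈-resp-~ (~-sym (β-inverts h)) (⁻¹-∈ h∈H)

        β-∉ : ∀ {y} → y ∉ H → β y ∉ H
        β-∉ {y} y∉H = y∉H ∘ subst (_∈ H) (β-involutive y) ∘ β-∈

        β-resp-~ : ∀ {a b} → a ~ b → β a ~ β b
        β-resp-~ {a} {b} a~b = subst (_∈ H) eq (β-∈ a~b)
          where
          eq : β (a ⁻¹ ∙ b) ≡ β a ⁻¹ ∙ β b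
          eq = trans (β-hom (a ⁻¹) b) (cong (_∙ β b) (∙-homo⇒⁻¹-homo β-hom a))

        β-reflects-~ : ∀ {a b} → β a ~ β b → a ~ b
        β-reflects-~ {a} {b} = subst₂ _~_ (β-involutive a) (β-involutive b) ∘ β-resp-~

        ~β⇒selfInverse : ∀ {t} → t ~ β t → t ~ t ⁻¹
        ~β⇒selfInverse {t} t~βt = ~-trans t~βt (β-inverts t)

        infix 4 _~±_
        _~±_ : Fin n → Fin n → Set
        a ~± b = a ~ b ⊎ a ⁻¹ ~ b

        ~±-sym : ∀ {a b} → a ~± b → b ~± a
        ~±-sym (inj₁ a~b)   = inj₁ (~-sym a~b)
        ~±-sym (inj₂ a⁻¹~b) = inj₂ (~-sym (⁻¹~⇒~⁻¹ a⁻¹~b))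

        ~±-trans : ∀ {a b c} → a ~± b → b ~± c → a ~± c
        ~±-trans (inj₁ a~b)   (inj₁ b~c)   = inj₁ (~-trans a~b b~c)
        ~±-trans (inj₁ a~b)   (inj₂ b⁻¹~c) = inj₂ (~-trans (~-⁻¹ a~b) b⁻¹~c)
        ~±-trans (inj₂ a⁻¹~b) (inj₁ b~c)   = inj₂ (~-trans a⁻¹~b b~c)
        ~±-trans (inj₂ a⁻¹~b) (inj₂ b⁻¹~c) = inj₁ (~-trans (⁻¹~⇒~⁻¹ a⁻¹~b) b⁻¹~c)

        ~±-isDecEquivalence : IsDecEquivalence _~±_
        ~±-isDecEquivalence = record
          { isEquivalence = record { refl = inj₁ ~-refl ; sym = ~±-sym ; trans = ~±-trans }
          ; _≟_ = λ a b → (a ~? b) ⊎-dec (a ⁻¹ ~? b)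
          }

        pairMin : Fin n → Fin n
        pairMin = leastInClass ~±-isDecEquivalence

        -- A self-inverse coset is represented by its element of order at most 2, a pair aH ≠ a⁻¹H
        -- by m = pairMin a in one coset and β m in the other.
        Representative : Fin n → Set
        Representative t = t ∙ t ≡ ε ⊎ (¬ t ~ t ⁻¹ × (t ≡ pairMin t ⊎ t ≡ β (pairMin t)))

        representative? : ∀ t → Dec (Representative t)
        representative? t =
          (t ∙ t ≟ ε) ⊎-dec (¬? (t ~? t ⁻¹) ×-dec ((t ≟ pairMin t) ⊎-dec (t ≟ β (pairMin t))))

        pairMin-~± : ∀ y → y ~± pairMin y
        pairMin-~± = ≈-leastInClass ~±-isDecEquivalence

        pairMin-cong : ∀ {a b} → a ~± b → pairMin a ≡ pairMin b
        pairMin-cong = leastInClass-cong ~±-isDecEquivalence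

        representative-∃ : ∀ y → ∃ λ t → y ~ t × Representative t
        representative-∃ y with y ~? y ⁻¹
        ... | yes y~y⁻¹ = let t , y~t , tt≡ε = ∃-square≡ε y~y⁻¹ in t , y~t , inj₁ tt≡ε
        ... | no ¬y~y⁻¹ with pairMin-~± y
        ...   | inj₁ y~m =
          pairMin y , y~m , inj₂ (¬y~y⁻¹ ∘ selfInverse-resp-~ (~-sym y~m) , inj₁ (pairMin-cong (inj₁ y~m)))
        ...   | inj₂ y⁻¹~m =
          β m , y~βm ,
          inj₂ (¬y~y⁻¹ ∘ selfInverse-resp-~ (~-sym y~βm) , inj₂ (cong β (pairMin-cong (inj₁ y~βm))))
          where
          m = pairMin y
          y~βm : y ~ β m
          y~βm = ~-trans (⁻¹~⇒~⁻¹ y⁻¹~m) (~-sym (β-inverts m))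

        representative-unique : ∀ {t t'} → t ~ t' → Representative t → Representative t' → t ≡ t'
        representative-unique t~t' (inj₁ tt≡ε) (inj₁ t't'≡ε) = square≡ε-unique t~t' tt≡ε t't'≡ε
        representative-unique t~t' (inj₁ tt≡ε) (inj₂ (¬t'~t'⁻¹ , _)) =
          contradiction (selfInverse-resp-~ t~t' (square≡ε⇒selfInverse tt≡ε)) ¬t'~t'⁻¹
        representative-unique t~t' (inj₂ (¬t~t⁻¹ , _)) (inj₁ t't'≡ε) =
          contradiction (selfInverse-resp-~ (~-sym t~t') (square≡ε⇒selfInverse t't'≡ε)) ¬t~t⁻¹
        representative-unique {t} {t'} t~t' (inj₂ (¬t~t⁻¹ , c)) (inj₂ (¬t'~t'⁻¹ , c')) = choice c c'
          where
          m≡m' : pairMin t ≡ pairMin t'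
          m≡m' = pairMin-cong (inj₁ t~t')
          choice : t ≡ pairMin t ⊎ t ≡ β (pairMin t) → t' ≡ pairMin t' ⊎ t' ≡ β (pairMin t') → t ≡ t'
          choice (inj₁ t≡m) (inj₁ t'≡m') = trans t≡m (trans m≡m' (sym t'≡m'))
          choice (inj₂ t≡βm) (inj₂ t'≡βm') = trans t≡βm (trans (cong β m≡m') (sym t'≡βm'))
          choice (inj₁ t≡m) (inj₂ t'≡βm') =
            contradiction (~β⇒selfInverse (subst (t ~_) t'≡βt t~t')) ¬t~t⁻¹
            where
            t'≡βt : t' ≡ β t
            t'≡βt = trans t'≡βm' (cong β (trans (sym m≡m') (sym t≡m)))
          choice (inj₂ t≡βm) (inj₁ t'≡m') =
            contradiction (~β⇒selfInverse (subst (t' ~_) t≡βt' (~-sym t~t'))) ¬t'~t'⁻¹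
            where
            t≡βt' : t ≡ β t'
            t≡βt' = trans t≡βm (cong β (trans m≡m' (sym t'≡m')))

        representative-β : ∀ {t} → Representative t → Representative (β t)
        representative-β {t} (inj₁ tt≡ε) = inj₁ (begin
          β t ∙ β t    ≡⟨ β-hom t t ⟨
          β (t ∙ t)    ≡⟨ cong β tt≡ε ⟩
          β ε          ≡⟨ ∙-homo⇒ε-homo β-hom ⟩
          ε            ∎)
        representative-β {t} (inj₂ (¬t~t⁻¹ , c)) = inj₂ (¬βt~βt⁻¹ , choice c)
          where
          ¬βt~βt⁻¹ : ¬ β t ~ β t ⁻¹
          ¬βt~βt⁻¹ = ¬t~t⁻¹ ∘ β-reflects-~ ∘ subst (β t ~_) (sym (∙-homo⇒⁻¹-homo β-hom t))
          m≡m' : pairMin t ≡ pairMin (β t)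
          m≡m' = pairMin-cong (inj₂ (~-sym (β-inverts t)))
          choice : t ≡ pairMin t ⊎ t ≡ β (pairMin t) →
                   β t ≡ pairMin (β t) ⊎ β t ≡ β (pairMin (β t))
          choice (inj₁ t≡m)  = inj₂ (cong β (trans t≡m m≡m'))
          choice (inj₂ t≡βm) = inj₁ (trans (cong β t≡βm) (trans (β-involutive _) m≡m'))

        InS : Fin n → Set
        InS s = s ∉ H × Representative s

        inS? : ∀ s → Dec (InS s)
        inS? s = ¬? (s ∈? H) ×-dec representative? s

        S : Subset n
        S = fromDecidable inS?

        S-∉ : ∀ {s} → s ∈ S → s ∉ H
        S-∉ = proj₁ ∘ ∈-fromDecidable⁻ inS?

        S-meets : ∀ {y} → y ∉ H → ∃ λ s → s ∈ S × y ~ s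
        S-meets {y} y∉H =
          let t , y~t , t-rep = representative-∃ y
          in t , ∈-fromDecidable⁺ inS? (y∉H ∘ ∈-resp-~ (~-sym y~t) , t-rep) , y~t

        S-unique : ∀ {s s'} → s ∈ S → s' ∈ S → s ~ s' → s ≡ s'
        S-unique s∈S s'∈S s~s' = representative-unique s~s'
          (proj₂ (∈-fromDecidable⁻ inS? s∈S)) (proj₂ (∈-fromDecidable⁻ inS? s'∈S))

        S-β : ∀ {s} → s ∈ S → β s ∈ S
        S-β s∈S =
          let s∉H , s-rep = ∈-fromDecidable⁻ inS? s∈S
          in ∈-fromDecidable⁺ inS? (β-∉ s∉H , representative-β s-rep)

  module GeneralizedCayley (α : Fin n → Fin n) (α-aut : IsInvolutoryAut G α) where
    private
      α-hom : ∀ x y → α (x ∙ y) ≡ α x ∙ α y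
      α-hom = proj₁ (proj₁ α-aut)
      α-involutive : ∀ x → α (α x) ≡ x
      α-involutive = proj₁ (proj₂ α-aut)

    β : Fin n → Fin n
    β x = α (x ⁻¹)

    β-hom : ∀ x y → β (x ∙ y) ≡ β x ∙ β y
    β-hom x y = trans (cong α (sym (⁻¹-∙-comm x y))) (α-hom (x ⁻¹) (y ⁻¹))

    β-involutive : ∀ x → β (β x) ≡ x
    β-involutive x = begin
      α (α (x ⁻¹) ⁻¹)  ≡⟨ cong α (∙-homo⇒⁻¹-homo α-hom (x ⁻¹)) ⟨
      α (α (x ⁻¹ ⁻¹))  ≡⟨ α-involutive (x ⁻¹ ⁻¹) ⟩
      x ⁻¹ ⁻¹          ≡⟨ ⁻¹-involutive x ⟩
      x                ∎

    α≡β⁻¹ : ∀ x → α x ≡ β x ⁻¹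
    α≡β⁻¹ x = trans (cong α (sym (⁻¹-involutive x))) (∙-homo⇒⁻¹-homo α-hom (x ⁻¹))

    ω : Fin n → Set
    ω = InOmega G α

    ω-∙ : ∀ {a b} → ω a → ω b → ω (a ∙ b)
    ω-∙ (g , refl) (h , refl) = g ∙ h , (begin
      (β g ∙ g) ∙ (β h ∙ h)  ≡⟨ interchange (β g) g (β h) h ⟩
      (β g ∙ β h) ∙ (g ∙ h)  ≡⟨ cong (_∙ (g ∙ h)) (β-hom g h) ⟨
      β (g ∙ h) ∙ (g ∙ h)    ∎)

    β-fixes-ω : ∀ {a} → ω a → β a ≡ a
    β-fixes-ω (g , refl) = begin
      β (β g ∙ g)      ≡⟨ β-hom (β g) g ⟩
      β (β g) ∙ β g    ≡⟨ cong (_∙ β g) (β-involutive g) ⟩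
      g ∙ β g          ≡⟨ comm g (β g) ⟩
      β g ∙ g          ∎

    ω-independent : ∀ {S g h} → (∀ {s} → s ∈ S → ¬ ω s) → ω g → ω h → ¬ GCAdj G α S g h
    ω-independent {g = g} {h} S∩ω≡∅ ωg ωh (inj₁ βg∙h∈S) =
      S∩ω≡∅ βg∙h∈S (subst (λ x → ω (x ∙ h)) (sym (β-fixes-ω ωg)) (ω-∙ ωg ωh))
    ω-independent {g = g} {h} S∩ω≡∅ ωg ωh (inj₂ βh∙g∈S) =
      S∩ω≡∅ βh∙g∈S (subst (λ x → ω (x ∙ g)) (sym (β-fixes-ω ωh)) (ω-∙ ωh ωg))

    ω⊆perfectCode : ∀ {S C} → (∀ {s} → s ∈ S → ¬ ω s) → IsPerfectCode G α S C →
                    (∀ c → c ∈ C → ω c) → ∀ x → ω x → x ∈ C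
    ω⊆perfectCode {C = C} S∩ω≡∅ (_ , C-dominating) C⊆ω x ωx with x ∈? C
    ... | yes x∈C = x∈C
    ... | no x∉C with c , c∈C , x-adj-c , _ ← C-dominating x x∉C =
      contradiction x-adj-c (ω-independent S∩ω≡∅ ωx (C⊆ω c c∈C))

    module Construction {H : Subset n} (H≤G : IsSubgroup G H) (odd : OddOrder G H)
                        (H≐ω : ∀ x → (x ∈ H → ω x) × (ω x → x ∈ H)) where
      open Cosets H≤G

      β-inverts : ∀ x → β x ~ x ⁻¹
      β-inverts x = proj₂ (H≐ω _) (x ⁻¹ , cong (_∙ x ⁻¹) (sym (∙-homo⇒⁻¹-homo β-hom x)))

      open OfOddOrder.InvariantTransversal odd β β-hom β-involutive β-inverts public

      S∩ω≡∅ : ∀ {s} → s ∈ S → ¬ ω s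
      S∩ω≡∅ s∈S = S-∉ s∈S ∘ proj₂ (H≐ω _)

      S-genCayley : IsGenCayleySubset G α S
      S-genCayley = S∩ω≡∅ , λ x →
        (λ (s , s∈S , x≡αs) → β s , S-β s∈S , trans x≡αs (α≡β⁻¹ s)) ,
        (λ (s , s∈S , x≡s⁻¹) → β s , S-β s∈S , trans x≡s⁻¹ (sym (α-involutive (s ⁻¹))))

      H-independent : ∀ {c c'} → c ∈ H → c' ∈ H → ¬ GCAdj G α S c c'
      H-independent c∈H c'∈H = ω-independent S∩ω≡∅ (proj₁ (H≐ω _) c∈H) (proj₁ (H≐ω _) c'∈H)

      adj⇒β∙∈S : ∀ {v c} → GCAdj G α S v c → β v ∙ c ∈ S
      adj⇒β∙∈S (inj₁ βv∙c∈S) = βv∙c∈S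
      adj⇒β∙∈S {v} {c} (inj₂ βc∙v∈S) = subst (_∈ S) eq (S-β βc∙v∈S)
        where
        eq : β (β c ∙ v) ≡ β v ∙ c
        eq = trans (β-hom (β c) v) (trans (cong (_∙ β v) (β-involutive c)) (comm c (β v)))

      H-dominating : ∀ v → v ∉ H →
                     ∃ λ c → c ∈ H × GCAdj G α S v c × (∀ c' → c' ∈ H → GCAdj G α S v c' → c' ≡ c)
      H-dominating v v∉H =
        let s , s∈S , βv~s = S-meets (β-∉ v∉H)
        in β v ⁻¹ ∙ s , βv~s , inj₁ (subst (_∈ S) (sym (\\-leftDividesˡ (β v) s)) s∈S) , unique s∈S βv~s
        where
        unique : ∀ {s} → s ∈ S → β v ~ s → ∀ c' → c' ∈ H → GCAdj G α S v c' → c' ≡ β v ⁻¹ ∙ s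
        unique {s} s∈S βv~s c' c'∈H v-adj-c' = begin
          c'                     ≡⟨ \\-leftDividesʳ (β v) c' ⟨
          β v ⁻¹ ∙ (β v ∙ c')    ≡⟨ cong (β v ⁻¹ ∙_) s≡βv∙c' ⟨
          β v ⁻¹ ∙ s             ∎
          where
          s≡βv∙c' : s ≡ β v ∙ c'
          s≡βv∙c' = S-unique s∈S (adj⇒β∙∈S v-adj-c') (~-trans (~-sym βv~s) (~-∙-∈ c'∈H))

      H-perfectCode : IsPerfectCode G α S H
      H-perfectCode = H-independent , H-dominating

proposition2p16 : (G : FinAbGroup) (H : Subset (FinAbGroup.n G))
    (α : Fin (FinAbGroup.n G) → Fin (FinAbGroup.n G))
    → IsSubgroup G H → OddOrder G H → IsInvolutoryAut G α
    → (∀ h → h ∈ H → InOmega G α h)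
    → ((Σ (Subset (FinAbGroup.n G)) λ S → IsGenCayleySubset G α S × IsPerfectCode G α S H)
        → (∀ x → (x ∈ H → InOmega G α x) × (InOmega G α x → x ∈ H)))
      × ((∀ x → (x ∈ H → InOmega G α x) × (InOmega G α x → x ∈ H))
        → Σ (Subset (FinAbGroup.n G)) λ S → IsGenCayleySubset G α S × IsPerfectCode G α S H)
proposition2p16 G H α H≤G odd α-aut H⊆ω =
  (λ (S , S-genCayley , H-perfectCode) x →
     H⊆ω x , ω⊆perfectCode (proj₁ S-genCayley) H-perfectCode H⊆ω x) ,
  (λ H≐ω → let open Construction H≤G odd H≐ω in S , S-genCayley , H-perfectCode)
  where open GeneralizedCayley G α α-aut
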